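{- Let $n\geq 6$ be an integer. Then the graph $L(n)$ is vertex-pancyclic: for every vertex $v$ of $L(n)$ and every integer $l$ with $3\leq l\leq n(n-1)$, there is a cycle of length $l$ in $L(n)$ containing $v$.
   Context: Let $n\geq 3$ and $[n]=\{1,2,\dots,n\}$. The graph $B(n)$ has vertex set $\{v : v\subset [n],\ |v|\in\{1,2\}\}$, and two vertices $v,w$ are adjacent iff $v\subset w$ or $w\subset v$. The graph $L(n)$ is the line graph of $B(n)$. Equivalently, the vertices of $L(n)$ are the pairs $[i,ij]:=\{\{i\},\{i,j\}\}$ with $i,j\in[n]$, $i\neq j$ (so $L(n)$ has $n(n-1)$ vertices), and two distinct vertices $[i,ij]$ and $[r,rs]$ are adjacent iff $i=r$ or $\{i,j\}=\{r,s\}$. A graph of order $N>2$ is vertex-pancyclic if every vertex lies on a cycle of length $l$ for every $l$ with $3\leq l\leq N$. -}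

module Defs where

open import Data.Nat using (ℕ; zero; suc; _*_; _∸_; _≤_)
open import Data.Fin using (Fin; zero; suc; fromℕ; inject₁)
open import Data.Product using (Σ; _×_; _,_; proj₁; proj₂)
open import Data.Sum using (_⊎_)
open import Relation.Binary.PropositionalEquality using (_≡_; _≢_)

-- A vertex [i, ij] of L(n): an ordered pair (i , j) of distinct elements of [n]
-- ([n] is represented by Fin n). There are n(n-1) of them.
LVertex : ℕ → Set
LVertex n = Σ (Fin n × Fin n) λ p → proj₁ p ≢ proj₂ p

vtx-i : ∀ {n} → LVertex n → Fin n
vtx-i v = proj₁ (proj₁ v)

vtx-j : ∀ {n} → LVertex n → Fin n
vtx-j v = proj₂ (proj₁ v)

LAdj : (n : ℕ) → LVertex n → LVertex n → Set
LAdj n v w =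
  (proj₁ v ≢ proj₁ w) ×
  ( (vtx-i v ≡ vtx-i w)
  ⊎ ((vtx-i v ≡ vtx-i w × vtx-j v ≡ vtx-j w)
     ⊎ (vtx-i v ≡ vtx-j w × vtx-j v ≡ vtx-i w)))

-- A cycle of length l = suc m (l ≥ 3 imposed separately) in a graph with vertex
-- type V and adjacency Adj: an injective sequence c 0, …, c m of vertices with
-- c k adjacent to c (k+1) for k < m, and c m adjacent to c 0.
record Cycle (V : Set) (Adj : V → V → Set) (m : ℕ) : Set where
  field
    vert   : Fin (suc m) → V
    inj    : ∀ a b → vert a ≡ vert b → a ≡ b
    step   : ∀ (k : Fin m) → Adj (vert (inject₁ k)) (vert (suc k))
    close  : Adj (vert (fromℕ m)) (vert zero)

OnCycle : ∀ {V Adj m} → V → Cycle V Adj m → Set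
OnCycle {m = m} v c = Σ (Fin (suc m)) λ k → Cycle.vert c k ≡ v

LVertexPancyclic : ℕ → Set
LVertexPancyclic n =
  ∀ (v : LVertex n) (l : ℕ) → 3 ≤ l → l ≤ n * (n ∸ 1) →
  Σ (Cycle (LVertex n) (LAdj n) (l ∸ 1)) λ c → OnCycle v c

{-# OPTIONS --safe #-}
module Submission where

-- L(n) is the union of n cliques, the block of x consisting of the n − 1 vertices [x, xy],
-- together with the perfect matching [x, xy] — [y, xy]. A cycle of length l ≤ n − 1 stays in
-- one block. Longer cycles visit blocks x₁, …, x_k in cyclic order, entering the block of xᵢ
-- at [xᵢ, xᵢxᵢ₋₁], leaving it at [xᵢ, xᵢxᵢ₊₁] and visiting up to n − 3 further vertices of the
-- block in between. Three blocks give every length from 6 to 2n, and all n blocks (xᵢ₊₁ = xᵢ − 1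
-- mod n) every length from 2n to n(n − 1); for n ≥ 6 these ranges and 3, …, n − 1 cover
-- everything. The cycles are built on pairs of naturals and then relabelled by a permutation
-- of [n] that carries their first vertex to the prescribed one.

open import Defs
open import Data.Nat using (ℕ; zero; suc; _+_; _*_; _∸_; _⊓_; _≤_; _<_; z≤n; s≤s; z<s; s<s; _≤?_)
open import Data.Nat.Properties
open import Data.Nat.DivMod using (_%_; m%n<n; %-distribˡ-+; [m+n]%n≡m%n; m<n⇒m%n≡m; n%n≡0)
open import Data.Fin as Fin using (Fin; inject₁; fromℕ; fromℕ<)
open import Data.Fin.Properties using (fromℕ<-injective; fromℕ<-cong)
open import Data.Fin.Permutation using (Permutation′; _⟨$⟩ʳ_; _∘ₚ_; transpose)
import Data.Fin.Permutation.Components as PC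
open import Data.Product using (Σ; _×_; _,_; proj₁; proj₂)
open import Data.Product.Properties using (×-≡,≡←≡; ≡-dec)
open import Data.Sum using (_⊎_; inj₁; inj₂)
open import Data.Empty using (⊥; ⊥-elim)
open import Data.Unit using (⊤; tt)
open import Relation.Nullary using (Dec; yes; no)
open import Data.List using (List; []; _∷_; _++_; [_]; length; lookup; map; concatMap; applyUpTo)
open import Data.List.Properties using (length-++; length-map; length-applyUpTo; ++-assoc)
open import Data.List.Relation.Unary.All as All using (All; []; _∷_; head)
import Data.List.Relation.Unary.All.Properties as AllP
open import Data.List.Relation.Unary.AllPairs as AllPairs using (AllPairs; []; _∷_)
import Data.List.Relation.Unary.AllPairs.Properties as AllPairsP
open import Data.List.Relation.Unary.Linked using (Linked; []; [-]; _∷_)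
open import Data.List.Relation.Unary.Linked.Properties using (AllPairs⇒Linked)
open import Data.List.Membership.Propositional.Properties using (∈-lookup)
open import Function using (_∘_)
open import Function.Bundles using (Injection)
open import Function.Properties.Inverse using (↔⇒↣)
open import Relation.Nullary.Decidable using (dec-true; dec-false)
open import Relation.Binary.PropositionalEquality hiding ([_])
open import Data.Nat.Tactic.RingSolver using (solve-∀)

lookup-injective : ∀ {A : Set} {xs : List A} → AllPairs _≢_ xs → ∀ i j → lookup xs i ≡ lookup xs j → i ≡ j
lookup-injective (_  ∷ _)   Fin.zero    Fin.zero    _  = refl
lookup-injective (x∉ ∷ _)   Fin.zero    (Fin.suc j) x≡ = ⊥-elim (All.lookup x∉ (∈-lookup j) x≡)
lookup-injective (x∉ ∷ _)   (Fin.suc i) Fin.zero    ≡x = ⊥-elim (All.lookup x∉ (∈-lookup i) (sym ≡x))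
lookup-injective (_  ∷ xs!) (Fin.suc i) (Fin.suc j) eq = cong Fin.suc (lookup-injective xs! i j eq)

module _ {K : Set} {_R_ : K → K → Set} where

  lookup-linked : ∀ {x xs ys} → Linked _R_ (x ∷ xs ++ ys) →
                  ∀ k → lookup (x ∷ xs) (inject₁ k) R lookup (x ∷ xs) (Fin.suc k)
  lookup-linked {xs = _ ∷ _} (xRy ∷ _) Fin.zero = xRy
  lookup-linked {xs = _ ∷ xs} (_ ∷ rest) (Fin.suc k) = lookup-linked {xs = xs} rest k

  lookup-last-linked : ∀ {x xs y} → Linked _R_ (x ∷ xs ++ [ y ]) → lookup (x ∷ xs) (fromℕ (length xs)) R y
  lookup-last-linked {xs = []} (xRy ∷ [-]) = xRy
  lookup-last-linked {xs = _ ∷ xs} (_ ∷ rest) = lookup-last-linked {xs = xs} rest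

  module _ {V : Set} {_~_ : V → V → Set} {P : K → Set}
           (f : ∀ k → P k → V)
           (f-injective : ∀ {k k′} {p : P k} {p′ : P k′} → f k p ≡ f k′ p′ → k ≡ k′)
           (f-adjacent : ∀ {k k′} {p : P k} {p′ : P k′} → k R k′ → f k p ~ f k′ p′) where

    listCycle : ∀ x xs → AllPairs _≢_ (x ∷ xs) → All P (x ∷ xs) → Linked _R_ (x ∷ xs ++ [ x ]) →
                Cycle V _~_ (length xs)
    listCycle x xs distinct ps linked = record
      { vert  = λ i → f (lookup (x ∷ xs) i) (All.lookup ps (∈-lookup i))
      ; inj   = λ i j eq → lookup-injective distinct i j (f-injective eq)
      ; step  = λ k → f-adjacent (lookup-linked {xs = xs} linked k)
      ; close = f-adjacent (lookup-last-linked linked)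
      }

module _ {n : ℕ} where

  transpose-sends : (i j : Fin n) → PC.transpose i j i ≡ j
  transpose-sends i j rewrite dec-true (i Fin.≟ i) refl = refl

  transpose-fixes : {i j k : Fin n} → k ≢ i → k ≢ j → PC.transpose i j k ≡ k
  transpose-fixes {i} {j} {k} k≢i k≢j rewrite dec-false (k Fin.≟ i) k≢i | dec-false (k Fin.≟ j) k≢j = refl

  permutation-injective : (π : Permutation′ n) → ∀ {i j} → π ⟨$⟩ʳ i ≡ π ⟨$⟩ʳ j → i ≡ j
  permutation-injective π = Injection.injective (↔⇒↣ π)

  twoPoint-transitive : ∀ {a b a′ b′ : Fin n} → a ≢ b → a′ ≢ b′ →
                        Σ (Permutation′ n) λ π → π ⟨$⟩ʳ a ≡ a′ × π ⟨$⟩ʳ b ≡ b′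
  twoPoint-transitive {a} {b} {a′} {b′} a≢b a′≢b′ = σ ∘ₚ τ , τσa≡a′ , transpose-sends c b′
    where
    σ = transpose a a′
    c = σ ⟨$⟩ʳ b
    a′≢c : a′ ≢ c
    a′≢c a′≡c = a≢b (permutation-injective σ (trans (transpose-sends a a′) a′≡c))
    τ = transpose c b′
    τσa≡a′ : τ ⟨$⟩ʳ (σ ⟨$⟩ʳ a) ≡ a′
    τσa≡a′ rewrite transpose-sends a a′ = transpose-fixes a′≢c a′≢b′

-- A vertex carries a proof of i ≢ j, and without function extensionality two such proofs need
-- not be equal; so that a prescribed vertex v lies on a cycle literally, snapTo v replaces a
-- vertex with the coordinates of v by v itself.
snapTo : ∀ {n} → LVertex n → LVertex n → LVertex n
snapTo (q , q-distinct) (p , p-distinct) = p , distinctness (≡-dec Fin._≟_ Fin._≟_ p q)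
  where
  distinctness : Dec (p ≡ q) → proj₁ p ≢ proj₂ p
  distinctness (yes refl) = q-distinct
  distinctness (no _)     = p-distinct

snapTo-target : ∀ {n} (v w : LVertex n) → proj₁ w ≡ proj₁ v → snapTo v w ≡ v
snapTo-target (q , _) (.q , _) refl with ≡-dec Fin._≟_ Fin._≟_ q q
... | yes refl = refl
... | no q≢q   = ⊥-elim (q≢q refl)

-- (x , y) stands for the vertex [x, xy]; its block is x.
Pair : Set
Pair = ℕ × ℕ

infix 4 _∼_
_∼_ : Pair → Pair → Set
(x , y) ∼ (x′ , y′) = (x , y) ≢ (x′ , y′) × (x ≡ x′ ⊎ (x ≡ y′ × y ≡ x′))

Valid : ℕ → Pair → Set
Valid n (x , y) = x < n × y < n × x ≢ y

IsPairCycle : ℕ → List Pair → Set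
IsPairCycle n []       = ⊥
IsPairCycle n (x ∷ xs) = AllPairs _≢_ (x ∷ xs) × All (Valid n) (x ∷ xs) × Linked _∼_ (x ∷ xs ++ [ x ])

module _ {n : ℕ} (v : LVertex n) (π : Permutation′ n) where

  label : (x : ℕ) → .(x < n) → Fin n
  label x x<n = π ⟨$⟩ʳ fromℕ< x<n

  label-injective : ∀ x y .{x<n : x < n} .{y<n : y < n} → label x x<n ≡ label y y<n → x ≡ y
  label-injective x y eq = fromℕ<-injective x y _ _ (permutation-injective π eq)

  label-cong : ∀ {x y} .{x<n : x < n} .{y<n : y < n} → x ≡ y → label x x<n ≡ label y y<n
  label-cong {x} {y} eq = cong (π ⟨$⟩ʳ_) (fromℕ<-cong x y eq _ _)

  labelVertex : (u : Pair) → Valid n u → LVertex n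
  labelVertex (x , y) (x<n , y<n , x≢y) = (label x x<n , label y y<n) , λ eq → x≢y (label-injective x y eq)

  vertexAt : (u : Pair) → Valid n u → LVertex n
  vertexAt u pu = snapTo v (labelVertex u pu)

  vertexAt-target : ∀ u pu → proj₁ (vertexAt u pu) ≡ proj₁ v → vertexAt u pu ≡ v
  vertexAt-target u pu = snapTo-target v (labelVertex u pu)

  vertexAt-injective : ∀ u w {pu : Valid n u} {pw : Valid n w} →
                       proj₁ (vertexAt u pu) ≡ proj₁ (vertexAt w pw) → u ≡ w
  vertexAt-injective (x , y) (x′ , y′) eq with ×-≡,≡←≡ eq
  ... | x≡ , y≡ = cong₂ _,_ (label-injective x x′ x≡) (label-injective y y′ y≡)

  vertexAt-adjacent : ∀ u w {pu : Valid n u} {pw : Valid n w} → u ∼ w → LAdj n (vertexAt u pu) (vertexAt w pw)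
  vertexAt-adjacent u w {pu} {pw} (u≢w , inj₁ x≡x′) =
    u≢w ∘ vertexAt-injective u w {pu} {pw} , inj₁ (label-cong x≡x′)
  vertexAt-adjacent u w {pu} {pw} (u≢w , inj₂ (x≡y′ , y≡x′)) =
    u≢w ∘ vertexAt-injective u w {pu} {pw} , inj₂ (inj₂ (label-cong x≡y′ , label-cong y≡x′))

pairCycle-through : ∀ {n} (v : LVertex n) C → IsPairCycle n C →
                    Σ (Cycle (LVertex n) (LAdj n) (length C ∸ 1)) (OnCycle v)
pairCycle-through {n} v ((p , q) ∷ xs) (distinct , valid@((p<n , q<n , p≢q) ∷ _) , linked) =
  let π , πp≡ , πq≡ = twoPoint-transitive (λ eq → p≢q (fromℕ<-injective p q p<n q<n eq)) (proj₂ v)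
  in  listCycle (vertexAt v π)
                (λ {u} {w} {pu} {pw} eq → vertexAt-injective v π u w {pu} {pw} (cong proj₁ eq))
                (λ {u} {w} {pu} {pw} → vertexAt-adjacent v π u w {pu} {pw})
                (p , q) xs distinct valid linked ,
      Fin.zero , vertexAt-target v π (p , q) (head valid) (cong₂ _,_ πp≡ πq≡)

record Segment : Set where
  constructor segment
  field
    block entry : ℕ
    middle      : List ℕ
    exit        : ℕ
open Segment

labels : Segment → List ℕ
labels s = entry s ∷ middle s ++ [ exit s ]

path : Segment → List Pair
path s = map (block s ,_) (labels s)

start : Segment → Pair
start s = block s , entry s

turn : Segment → Pair
turn s = exit s , block s

IsLabel : ℕ → ℕ → ℕ → Set
IsLabel n x y = y < n × x ≢ y

SegmentOK : ℕ → Segment → Set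
SegmentOK n s = block s < n × All (IsLabel n (block s)) (labels s) × AllPairs _≢_ (labels s)

sameBlock-adjacent : ∀ x {y y′} → y ≢ y′ → (x , y) ∼ (x , y′)
sameBlock-adjacent x y≢y′ = (λ eq → y≢y′ (cong proj₂ eq)) , inj₁ refl

blockPath-linked : ∀ x p ms q {t ts} → Linked _≢_ (p ∷ ms ++ [ q ]) → (x , q) ∼ t → Linked _∼_ (t ∷ ts) →
                   Linked _∼_ (map (x ,_) (p ∷ ms ++ [ q ]) ++ t ∷ ts)
blockPath-linked x p []       q (p≢q ∷ [-])  q∼t linked = sameBlock-adjacent x p≢q ∷ q∼t ∷ linked
blockPath-linked x p (m ∷ ms) q (p≢m ∷ rest) q∼t linked =
  sameBlock-adjacent x p≢m ∷ blockPath-linked x m ms q rest q∼t linked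

segment-linked : ∀ {n} s {t ts} → SegmentOK n s → turn s ≡ t → Linked _∼_ (t ∷ ts) → Linked _∼_ (path s ++ t ∷ ts)
segment-linked s (_ , ok , distinct) refl =
  blockPath-linked (block s) (entry s) (middle s) (exit s) (AllPairs⇒Linked distinct)
                   ((λ eq → block≢exit (cong proj₁ eq)) , inj₂ (refl , refl))
  where
  block≢exit : block s ≢ exit s
  block≢exit = proj₂ (head (AllP.++⁻ʳ (middle s) (All.tail ok)))

path-unique : ∀ s → AllPairs _≢_ (labels s) → AllPairs _≢_ (path s)
path-unique s distinct = AllPairsP.map⁺ (AllPairs.map (λ y≢y′ eq → y≢y′ (cong proj₂ eq)) distinct)

path-valid : ∀ {n} s → SegmentOK n s → All (Valid n) (path s)
path-valid s (x<n , ok , _) = AllP.map⁺ (All.map (λ (y<n , x≢y) → x<n , y<n , x≢y) ok)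

path-block : ∀ s → All (λ u → proj₁ u ≡ block s) (path s)
path-block s = AllP.map⁺ (All.tabulate (λ _ → refl))

walk : List Segment → List Pair
walk = concatMap path

walk-avoids : ∀ x ss → All (λ t → x ≢ block t) ss → All (λ u → x ≢ proj₁ u) (walk ss)
walk-avoids x []       []             = []
walk-avoids x (s ∷ ss) (x≢s ∷ x≢ss) =
  AllP.++⁺ (All.map (λ u₁≡ x≡u₁ → x≢s (trans x≡u₁ u₁≡)) (path-block s)) (walk-avoids x ss x≢ss)

nextStart : Pair → List Segment → Pair
nextStart z []      = z
nextStart z (t ∷ _) = start t

Chain : ℕ → Pair → List Segment → Set
Chain n z []       = ⊤
Chain n z (s ∷ ss) = SegmentOK n s × All (λ t → block s ≢ block t) ss × turn s ≡ nextStart z ss × Chain n z ss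

chain-linked : ∀ {n z} ss → Chain n z ss → Linked _∼_ (walk ss ++ [ z ])
chain-linked []              _                         = [-]
chain-linked {z = z} (s ∷ []) (ok , _ , turn≡ , _) =
  subst (Linked _∼_) (sym (++-assoc (path s) [] [ z ])) (segment-linked s ok turn≡ [-])
chain-linked {z = z} (s ∷ ss@(_ ∷ _)) (ok , _ , turn≡ , chain) =
  subst (Linked _∼_) (sym (++-assoc (path s) (walk ss) [ z ])) (segment-linked s ok turn≡ (chain-linked ss chain))

chain-unique : ∀ {n z} ss → Chain n z ss → AllPairs _≢_ (walk ss)
chain-unique []       _                                     = []
chain-unique (s ∷ ss) ((_ , _ , distinct) , s≢ss , _ , chain) =
  AllPairsP.++⁺ (path-unique s distinct) (chain-unique ss chain)
    (All.map (λ u₁≡ → All.map (λ s≢w u≡w → s≢w (trans (sym u₁≡) (cong proj₁ u≡w))) (walk-avoids (block s) ss s≢ss))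
             (path-block s))

chain-valid : ∀ {n z} ss → Chain n z ss → All (Valid n) (walk ss)
chain-valid []       _                  = []
chain-valid (s ∷ ss) (ok , _ , _ , chain) = AllP.++⁺ (path-valid s ok) (chain-valid ss chain)

closedChain-cycle : ∀ {n z} s ss → Chain n z (s ∷ ss) → start s ≡ z → IsPairCycle n (walk (s ∷ ss))
closedChain-cycle s ss chain refl = chain-unique (s ∷ ss) chain , chain-valid (s ∷ ss) chain , chain-linked (s ∷ ss) chain

framedSegment-ok : ∀ {n x p q} g e → x < n → IsLabel n x p → IsLabel n x q → (∀ {d} → d < e → IsLabel n x (g d)) →
                   p ≢ q → (∀ {d} → d < e → g d ≢ p × g d ≢ q) → (∀ {i j} → i < j → j < e → g i ≢ g j) →
                   SegmentOK n (segment x p (applyUpTo g e) q)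
framedSegment-ok g e x<n p-label q-label g-label p≢q g-fresh g-injective =
  x<n ,
  p-label ∷ AllP.++⁺ (AllP.applyUpTo⁺₁ g e g-label) (q-label ∷ []) ,
  AllP.++⁺ (AllP.applyUpTo⁺₁ g e (λ d<e → ≢-sym (proj₁ (g-fresh d<e)))) (p≢q ∷ []) ∷
  AllPairsP.++⁺ (AllPairsP.applyUpTo⁺₁ g e g-injective) ([] ∷ [])
                (AllP.applyUpTo⁺₁ g e (λ d<e → proj₂ (g-fresh d<e) ∷ []))

framedPath-length : ∀ x p g e q → length (path (segment x p (applyUpTo g e) q)) ≡ 2 + e
framedPath-length x p g e q = begin
  length (path (segment x p (applyUpTo g e) q))  ≡⟨ length-map (x ,_) (p ∷ applyUpTo g e ++ [ q ]) ⟩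
  suc (length (applyUpTo g e ++ [ q ]))          ≡⟨ cong suc (length-++ (applyUpTo g e)) ⟩
  suc (length (applyUpTo g e) + 1)               ≡⟨ cong (λ k → suc (k + 1)) (length-applyUpTo g e) ⟩
  suc (e + 1)                                    ≡⟨ cong suc (+-comm e 1) ⟩
  2 + e                                          ∎
  where open ≡-Reasoning

oneBlock-cycle : ∀ {n l} → 3 ≤ l → l < n → Σ (List Pair) λ C → length C ≡ l × IsPairCycle n C
oneBlock-cycle {n} {l = suc (suc (suc k))} (s≤s (s≤s (s≤s _))) l<n =
  path s , framedPath-length 0 1 (2 +_) (suc k) (3 + k) ,
  path-unique s distinct , path-valid s ok ,
  blockPath-linked 0 1 (middle s) (3 + k) (AllPairs⇒Linked distinct) (sameBlock-adjacent 0 (λ ())) [-]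
  where
  s = segment 0 1 (applyUpTo (2 +_) (suc k)) (3 + k)
  inner<l : ∀ {d} → d < suc k → 2 + d < 3 + k
  inner<l = +-monoʳ-< 2
  ok : SegmentOK n s
  ok = framedSegment-ok (2 +_) (suc k) (≤-trans (s≤s z≤n) l<n) (≤-trans (s≤s (s≤s z≤n)) l<n , λ ()) (l<n , λ ())
         (λ d<e → <-trans (inner<l d<e) l<n , λ ()) (λ ())
         (λ d<e → (λ ()) , <⇒≢ (inner<l d<e)) (λ i<j _ → <⇒≢ (+-monoʳ-< 2 i<j))
  distinct = proj₂ (proj₂ ok)

triangleSegment : ℕ → ℕ → ℕ → ℕ → Segment
triangleSegment x p q e = segment x p (applyUpTo (3 +_) e) q

triangleSegment-ok : ∀ {E x p q e} → x < 3 → p < 3 → q < 3 → x ≢ p → x ≢ q → p ≢ q → e ≤ E →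
                     SegmentOK (3 + E) (triangleSegment x p q e)
triangleSegment-ok {E} x<3 p<3 q<3 x≢p x≢q p≢q e≤E =
  framedSegment-ok (3 +_) _ (<3⇒<n x<3) (<3⇒<n p<3 , x≢p) (<3⇒<n q<3 , x≢q)
    (λ d<e → +-monoʳ-< 3 (≤-trans d<e e≤E) , <3⇒≢ x<3) p≢q
    (λ _ → ≢-sym (<3⇒≢ p<3) , ≢-sym (<3⇒≢ q<3)) (λ i<j _ → <⇒≢ (+-monoʳ-< 3 i<j))
  where
  <3⇒<n : ∀ {y} → y < 3 → y < 3 + E
  <3⇒<n y<3 = ≤-trans y<3 (m≤m+n 3 E)
  <3⇒≢ : ∀ {y d} → y < 3 → y ≢ 3 + d
  <3⇒≢ {d = d} y<3 = <⇒≢ (≤-trans y<3 (m≤m+n 3 d))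

triangle : ℕ → ℕ → List Segment
triangle e₀ e₁ = triangleSegment 0 2 1 e₀ ∷ triangleSegment 1 0 2 e₁ ∷ triangleSegment 2 1 0 0 ∷ []

triangle-chain : ∀ {E e₀ e₁} → e₀ ≤ E → e₁ ≤ E → Chain (3 + E) (0 , 2) (triangle e₀ e₁)
triangle-chain e₀≤E e₁≤E =
  triangleSegment-ok 0<3 2<3 1<3 (λ ()) (λ ()) (λ ()) e₀≤E , (λ ()) ∷ (λ ()) ∷ [] , refl ,
  triangleSegment-ok 1<3 0<3 2<3 (λ ()) (λ ()) (λ ()) e₁≤E , (λ ()) ∷ [] , refl ,
  triangleSegment-ok 2<3 1<3 0<3 (λ ()) (λ ()) (λ ()) z≤n , [] , refl , tt
  where
  0<3 : 0 < 3
  0<3 = z<s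
  1<3 : 1 < 3
  1<3 = s<s z<s
  2<3 : 2 < 3
  2<3 = s<s (s<s z<s)

triangle-length : ∀ e₀ e₁ → length (walk (triangle e₀ e₁)) ≡ 6 + (e₀ + e₁)
triangle-length e₀ e₁ = begin
  length (path s₀ ++ path s₁ ++ path s₂)         ≡⟨ length-++ (path s₀) ⟩
  length (path s₀) + length (path s₁ ++ path s₂)  ≡⟨ cong (length (path s₀) +_) (length-++ (path s₁)) ⟩
  length (path s₀) + (length (path s₁) + 2)
    ≡⟨ cong₂ (λ a b → a + (b + 2)) (framedPath-length 0 2 (3 +_) e₀ 1) (framedPath-length 1 0 (3 +_) e₁ 2) ⟩
  2 + e₀ + (2 + e₁ + 2)                            ≡⟨ regroup e₀ e₁ ⟩
  6 + (e₀ + e₁)                                    ∎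
  where
  open ≡-Reasoning
  s₀ = triangleSegment 0 2 1 e₀
  s₁ = triangleSegment 1 0 2 e₁
  s₂ = triangleSegment 2 1 0 0
  regroup : ∀ a b → 2 + a + (2 + b + 2) ≡ 6 + (a + b)
  regroup = solve-∀

triangle-cycle : ∀ {E l} → 6 ≤ l → l ≤ 6 + (E + E) → Σ (List Pair) λ C → length C ≡ l × IsPairCycle (3 + E) C
triangle-cycle {E} {l} 6≤l l≤ =
  walk (triangle e₀ e₁) , length≡ ,
  closedChain-cycle (triangleSegment 0 2 1 e₀) _ (triangle-chain (m⊓n≤m E b) (m≤n+o⇒m∸n≤o b E (∸-monoˡ-≤ 6 l≤))) refl
  where
  b  = l ∸ 6
  e₀ = E ⊓ b
  e₁ = b ∸ E
  length≡ : length (walk (triangle e₀ e₁)) ≡ l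
  length≡ = trans (triangle-length e₀ e₁) (trans (cong (6 +_) (m⊓n+n∸m≡n E b)) (m+[n∸m]≡n 6≤l))

-- Addition modulo n = suc N, in which the offset N acts as −1.
module Rotation (N : ℕ) where

  rot : ℕ → ℕ → ℕ
  rot x d = (x + d) % suc N

  rot<n : ∀ x d → rot x d < suc N
  rot<n x d = m%n<n (x + d) (suc N)

  rot-undo : ∀ {x} d → x < suc N → (x + d + (suc N ∸ x)) % suc N ≡ d % suc N
  rot-undo {x} d x<n = begin
    (x + d + (suc N ∸ x)) % suc N    ≡⟨ cong (λ r → (r + (suc N ∸ x)) % suc N) (+-comm x d) ⟩
    (d + x + (suc N ∸ x)) % suc N    ≡⟨ cong (_% suc N) (+-assoc d x (suc N ∸ x)) ⟩
    (d + (x + (suc N ∸ x))) % suc N  ≡⟨ cong (λ r → (d + r) % suc N) (m+[n∸m]≡n (<⇒≤ x<n)) ⟩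
    (d + suc N) % suc N              ≡⟨ [m+n]%n≡m%n d (suc N) ⟩
    d % suc N                        ∎
    where open ≡-Reasoning

  rot-injective : ∀ {x d₁ d₂} → x < suc N → d₁ < suc N → d₂ < suc N → rot x d₁ ≡ rot x d₂ → d₁ ≡ d₂
  rot-injective {x} {d₁} {d₂} x<n d₁<n d₂<n eq = begin
    d₁                                             ≡⟨ m<n⇒m%n≡m d₁<n ⟨
    d₁ % suc N                                     ≡⟨ rot-undo d₁ x<n ⟨
    (x + d₁ + (suc N ∸ x)) % suc N                 ≡⟨ %-distribˡ-+ (x + d₁) (suc N ∸ x) (suc N) ⟩
    (rot x d₁ + (suc N ∸ x) % suc N) % suc N       ≡⟨ cong (λ r → (r + (suc N ∸ x) % suc N) % suc N) eq ⟩
    (rot x d₂ + (suc N ∸ x) % suc N) % suc N       ≡⟨ %-distribˡ-+ (x + d₂) (suc N ∸ x) (suc N) ⟨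
    (x + d₂ + (suc N ∸ x)) % suc N                 ≡⟨ rot-undo d₂ x<n ⟩
    d₂ % suc N                                     ≡⟨ m<n⇒m%n≡m d₂<n ⟩
    d₂                                             ∎
    where open ≡-Reasoning

  rot-distinct : ∀ {x d₁ d₂} → x < suc N → d₁ < suc N → d₂ < suc N → d₁ ≢ d₂ → rot x d₁ ≢ rot x d₂
  rot-distinct x<n d₁<n d₂<n d₁≢d₂ eq = d₁≢d₂ (rot-injective x<n d₁<n d₂<n eq)

  rot-zero : ∀ {x} → x < suc N → rot x 0 ≡ x
  rot-zero {x} x<n = trans (cong (_% suc N) (+-identityʳ x)) (m<n⇒m%n≡m x<n)

  rot-≢ : ∀ {x d} → x < suc N → 0 < d → d < suc N → x ≢ rot x d
  rot-≢ x<n 0<d d<n eq = <⇒≢ 0<d (rot-injective x<n z<s d<n (trans (rot-zero x<n) eq))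

  rot-one : ∀ {x} → suc x < suc N → rot x 1 ≡ suc x
  rot-one {x} sx<n = trans (cong (_% suc N) (+-comm x 1)) (m<n⇒m%n≡m sx<n)

  rot-one-wraps : rot N 1 ≡ 0
  rot-one-wraps = trans (cong (_% suc N) (+-comm N 1)) (n%n≡0 (suc N))

  rot-minusOne : ∀ {j} → j < suc N → rot (suc j) N ≡ j
  rot-minusOne {j} j<n = trans (cong (_% suc N) (sym (+-suc j N))) (trans ([m+n]%n≡m%n j (suc N)) (m<n⇒m%n≡m j<n))

  rot-minusOne-wraps : rot 0 N ≡ N
  rot-minusOne-wraps = m<n⇒m%n≡m (n<1+n N)

module RotationChain (E : ℕ) where
  open Rotation (2 + E)

  cyclicSegment : ℕ → ℕ → Segment
  cyclicSegment x e = segment x (rot x 1) (applyUpTo (λ d → rot x (2 + d)) e) (rot x (2 + E))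

  cyclicSegment-ok : ∀ {x e} → x < 3 + E → e ≤ E → SegmentOK (3 + E) (cyclicSegment x e)
  cyclicSegment-ok {x} {e} x<n e≤E =
    framedSegment-ok _ e x<n (rot<n x 1 , rot-≢ x<n z<s 1<n) (rot<n x (2 + E) , rot-≢ x<n z<s N<n)
      (λ d<e → rot<n x _ , rot-≢ x<n z<s (inner<n d<e)) (rot-distinct x<n 1<n N<n (λ ()))
      (λ d<e → rot-distinct x<n (inner<n d<e) 1<n (λ ()) ,
               rot-distinct x<n (inner<n d<e) N<n (<⇒≢ (+-monoʳ-< 2 (≤-trans d<e e≤E))))
      (λ i<j j<e → rot-distinct x<n (inner<n (<-trans i<j j<e)) (inner<n j<e) (<⇒≢ (+-monoʳ-< 2 i<j)))
    where
    1<n : 1 < 3 + E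
    1<n = s≤s (s≤s z≤n)
    N<n : 2 + E < 3 + E
    N<n = n<1+n (2 + E)
    inner<n : ∀ {d} → d < e → 2 + d < 3 + E
    inner<n d<e = +-monoʳ-≤ 3 (<⇒≤ (≤-trans d<e e≤E))

  rotationChain : ℕ → ℕ → List Segment
  rotationChain zero    b = []
  rotationChain (suc k) b = cyclicSegment k (E ⊓ b) ∷ rotationChain k (b ∸ E)

  rotationChain-blocks : ∀ k b → All (λ t → block t < k) (rotationChain k b)
  rotationChain-blocks zero    b = []
  rotationChain-blocks (suc k) b = n<1+n k ∷ All.map m<n⇒m<1+n (rotationChain-blocks k (b ∸ E))

  rotationChain-chain : ∀ k b → k ≤ 3 + E → Chain (3 + E) (2 + E , 0) (rotationChain k b)
  rotationChain-chain zero    b _   = tt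
  rotationChain-chain (suc k) b k<n =
    cyclicSegment-ok k<n (m⊓n≤m E b) ,
    All.map (λ t<k k≡t → <⇒≢ t<k (sym k≡t)) (rotationChain-blocks k (b ∸ E)) ,
    turn-next k {E ⊓ b} {b ∸ E} k<n ,
    rotationChain-chain k (b ∸ E) (<⇒≤ k<n)
    where
    turn-next : ∀ j {e b′} → j < 3 + E → turn (cyclicSegment j e) ≡ nextStart (2 + E , 0) (rotationChain j b′)
    turn-next zero    _    = cong (_, 0) rot-minusOne-wraps
    turn-next (suc j) j<n = cong₂ _,_ (rot-minusOne (<-trans (n<1+n j) j<n)) (sym (rot-one j<n))

  rotationChain-length : ∀ k b → b ≤ k * E → length (walk (rotationChain k b)) ≡ k * 2 + b
  rotationChain-length zero    b b≤0 = sym (n≤0⇒n≡0 b≤0)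
  rotationChain-length (suc k) b b≤  = begin
    length (path s ++ walk ss)                 ≡⟨ length-++ (path s) ⟩
    length (path s) + length (walk ss)
      ≡⟨ cong₂ _+_ (framedPath-length k (rot k 1) _ (E ⊓ b) (rot k (2 + E)))
                   (rotationChain-length k (b ∸ E) (m≤n+o⇒m∸n≤o b E b≤)) ⟩
    2 + E ⊓ b + (k * 2 + (b ∸ E))              ≡⟨ regroup (E ⊓ b) (k * 2) (b ∸ E) ⟩
    2 + k * 2 + (E ⊓ b + (b ∸ E))              ≡⟨ cong (2 + k * 2 +_) (m⊓n+n∸m≡n E b) ⟩
    suc k * 2 + b                              ∎
    where
    open ≡-Reasoning
    s  = cyclicSegment k (E ⊓ b)
    ss = rotationChain k (b ∸ E)
    regroup : ∀ a m c → 2 + a + (m + c) ≡ 2 + m + (a + c)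
    regroup = solve-∀

  rotation-cycle : ∀ {l} → (3 + E) * 2 ≤ l → l ≤ (3 + E) * (2 + E) →
                   Σ (List Pair) λ C → length C ≡ l × IsPairCycle (3 + E) C
  rotation-cycle {l} 2n≤l l≤ =
    walk (rotationChain (3 + E) b) , trans (rotationChain-length (3 + E) b b≤) (m+[n∸m]≡n 2n≤l) ,
    closedChain-cycle _ _ (rotationChain-chain (3 + E) b ≤-refl) (cong (2 + E ,_) rot-one-wraps)
    where
    b = l ∸ (3 + E) * 2
    b≤ : b ≤ (3 + E) * E
    b≤ = ≤-trans (∸-monoˡ-≤ ((3 + E) * 2) l≤) (≤-reflexive (sym (*-distribˡ-∸ (3 + E) (2 + E) 2)))

pairCycle-of-length : ∀ E → 3 ≤ E → ∀ l → 3 ≤ l → l ≤ (3 + E) * (2 + E) →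
                      Σ (List Pair) λ C → length C ≡ l × IsPairCycle (3 + E) C
pairCycle-of-length E 3≤E l 3≤l l≤ with l ≤? 2 + E | l ≤? 6 + (E + E)
... | yes l≤2+E | _        = oneBlock-cycle 3≤l (s≤s l≤2+E)
... | no  l≰2+E | yes l≤2n = triangle-cycle (≤-trans (+-monoʳ-≤ 3 3≤E) (≰⇒> l≰2+E)) l≤2n
... | no  _     | no  l≰2n = RotationChain.rotation-cycle E (≤-trans (≤-reflexive (double E)) (<⇒≤ (≰⇒> l≰2n))) l≤
  where
  double : ∀ m → (3 + m) * 2 ≡ 6 + (m + m)
  double = solve-∀

theorem2p3 : ∀ (n : ℕ) → 6 ≤ n → LVertexPancyclic n
theorem2p3 (suc (suc (suc E))) (s≤s (s≤s (s≤s 3≤E))) v l 3≤l l≤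
  with C , length≡ , isCycle ← pairCycle-of-length E 3≤E l 3≤l l≤ =
  subst (λ m → Σ (Cycle (LVertex (3 + E)) (LAdj (3 + E)) m) (OnCycle v)) (cong (_∸ 1) length≡)
        (pairCycle-through v C isCycle)
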